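{- Suppose $Act$ is finite with $|Act|\geq 2$. Then the axiom system $\mathcal{E}_{\omega,f}'=\mathcal{E}_v\cup\{Y_\omega,N_\omega,O1\}\cup\mathcal{O}$ is complete for $\omega$-verdict equivalence over open monitors: for all $m,n\in Mon_F$, if $m\simeq_\omega n$ then $\mathcal{E}_{\omega,f}'\vdash m=n$.
   Context: Fix a set $Act$ of visible actions, a symbol $\tau\notin Act$, and a countably infinite set $Var$ of variables disjoint from $Act\cup\{\tau\}$. Monitors $Mon_F$: $m,n ::= v \mid a.m \mid m+n \mid x$ ($a\in Act$, $x\in Var$), verdicts $v ::= \mathit{end}\mid \mathit{yes}\mid \mathit{no}$. Closed monitors contain no variables; (closed) substitutions map variables to (closed) monitors. $\sum_{i\in I}m_i$ is $\mathit{end}$ if $I=\emptyset$ and $m_{i_1}+\cdots+m_{i_k}$ otherwise. Transitions: for $\alpha\in Act\cup\{\tau\}$, $\xrightarrow{\alpha}$ is the least relation with $a.m\xrightarrow{a}m$; if $m\xrightarrow{\alpha}m'$ then $m+n\xrightarrow{\alpha}m'$ and $n+m\xrightarrow{\alpha}m'$; and $v\xrightarrow{\alpha}v$ for every verdict $v$ and every $\alpha$. Weak transitions: $m\xRightarrow{\varepsilon}m'$ iff $m(\xrightarrow{\tau})^*m'$; $m\xRightarrow{a}m'$ iff $m\xRightarrow{\varepsilon}m_1\xrightarrow{a}m_2\xRightarrow{\varepsilon}m'$; $m\xRightarrow{as'}m'$ ($s'\neq\varepsilon$) iff $m\xRightarrow{a}m_1\xRightarrow{s'}m'$. $L_a(m)=\{s\in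 Act^*\mid m\xRightarrow{s}\mathit{yes}\}$, $L_r(m)=\{s\in Act^*\mid m\xRightarrow{s}\mathit{no}\}$. Closed $m\simeq_\omega n$ iff $L_a(m)\cdot Act^\omega=L_a(n)\cdot Act^\omega$ and $L_r(m)\cdot Act^\omega=L_r(n)\cdot Act^\omega$; open $m\simeq_\omega n$ iff $\sigma(m)\simeq_\omega\sigma(n)$ for all closed $\sigma$. $\mathcal{E}\vdash m=n$: derivability by reflexivity, symmetry, transitivity, substitutivity and congruence for $a.\_$ and $+$. $\mathcal{E}_v$: (A1) $x+y=y+x$; (A2) $x+(y+z)=(x+y)+z$; (A3) $x+x=x$; (A4) $x+\mathit{end}=x$; for each $a\in Act$: $(E_a)$ $a.\mathit{end}=\mathit{end}$; $(Y_a)$ $\mathit{yes}=\mathit{yes}+a.\mathit{yes}$; $(N_a)$ $\mathit{no}=\mathit{no}+a.\mathit{no}$; $(D_a)$ $a.(x+y)=a.x+a.y$. $(Y_\omega)$: $\mathit{yes}=\sum_{a\in Act}a.\mathit{yes}$; $(N_\omega)$: $\mathit{no}=\sum_{a\in Act}a.\mathit{no}$; $(O1)$: $\mathit{yes}+\mathit{no}=\mathit{yes}+\mathit{no}+x$. Notation for $s\in Act^*$, monitor $m$: $\mathit{pre}(s)$ = prefixes of $s$ (including $\varepsilon$, $s$); $s^1=s$, $s^i=ss^{i-1}$; for $s=a_1\cdots a_k$, $s.m=a_1.\cdots a_k.m$; $\overline{s}^{\leq}(m)=\sum_{|s'|\leq|s|,\ s'\notin\mathit{pre}(s)}s'.m$;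 $\overline{s}(m)=\overline{s}^{\leq}(m)+s.\sum_{a\in Act}a.m$; $\overline{s}^{(1)}(m)=\overline{s}(m)$ and for $k\geq2$, $\overline{s}^{(k)}(m)=\sum_{1\leq i<k-1}s^i.\overline{s}^{\leq}(m)+s^{k-1}.\overline{s}(m)$. $\mathcal{O}$ is the family of equations $(O2_{s,k})$: $x+s.x+\overline{s}^{(k)}(\mathit{yes}+\mathit{no})=x+\overline{s}^{(k)}(\mathit{yes}+\mathit{no})$ for all $s\in Act^*$ and all $k$ for which $\overline{s}^{(k)}$ is defined. -}

module Defs where

open import Data.Nat using (ℕ; zero; suc; _≤_; _∸_)
open import Data.Fin using (Fin) renaming (_≟_ to _≟F_)
open import Data.Bool using (Bool; true; false; _∧_; not)
open import Data.List using (List; []; _∷_; _++_; map; concatMap; allFin; upTo; filterᵇ; foldr; length)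
open import Data.Product using (_×_; ∃; ∃₂; _,_)
open import Relation.Nullary using (does)
open import Relation.Binary.Construct.Closure.ReflexiveTransitive using (Star)

-- Act = Fin n (finite set of visible actions), Var = ℕ (countably infinite).

data Mon (n : ℕ) : Set where
  end yes no : Mon n
  _∙_ : Fin n → Mon n → Mon n
  _⊕_ : Mon n → Mon n → Mon n
  var : ℕ → Mon n

infixr 7 _∙_
infixl 6 _⊕_

data IsVerdict {n : ℕ} : Mon n → Set where
  v-end : IsVerdict end
  v-yes : IsVerdict yes
  v-no  : IsVerdict no

data Closed {n : ℕ} : Mon n → Set where
  c-end : Closed end
  c-yes : Closed yes
  c-no  : Closed no
  c-pre : ∀ {a m} → Closed m → Closed (a ∙ m)
  c-sum : ∀ {m k} → Closed m → Closed k → Closed (m ⊕ k)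

Subst : ℕ → Set
Subst n = ℕ → Mon n

ClosedSubst : ∀ {n} → Subst n → Set
ClosedSubst σ = ∀ x → Closed (σ x)

sub : ∀ {n} → Subst n → Mon n → Mon n
sub σ end = end
sub σ yes = yes
sub σ no = no
sub σ (a ∙ m) = a ∙ sub σ m
sub σ (m ⊕ k) = sub σ m ⊕ sub σ k
sub σ (var x) = σ x

data Lab (n : ℕ) : Set where
  act : Fin n → Lab n
  τ   : Lab n

data Step {n : ℕ} : Mon n → Lab n → Mon n → Set where
  s-pre  : ∀ {a m} → Step (a ∙ m) (act a) m
  s-sumL : ∀ {m k α m'} → Step m α m' → Step (m ⊕ k) α m'
  s-sumR : ∀ {m k α m'} → Step m α m' → Step (k ⊕ m) α m'
  s-verd : ∀ {v α} → IsVerdict v → Step v α v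

TauStar : ∀ {n} → Mon n → Mon n → Set
TauStar = Star (λ m m' → Step m τ m')

Weak1 : ∀ {n} → Fin n → Mon n → Mon n → Set
Weak1 a m m' = ∃₂ λ m₁ m₂ → TauStar m m₁ × Step m₁ (act a) m₂ × TauStar m₂ m'

Weak : ∀ {n} → List (Fin n) → Mon n → Mon n → Set
Weak [] = TauStar
Weak (a ∷ []) = Weak1 a
Weak (a ∷ b ∷ s) m m' = ∃ λ m₁ → Weak1 a m m₁ × Weak (b ∷ s) m₁ m'

La : ∀ {n} → Mon n → List (Fin n) → Set
La m s = Weak s m yes

Lr : ∀ {n} → Mon n → List (Fin n) → Set
Lr m s = Weak s m no

Omega : ℕ → Set
Omega n = ℕ → Fin n

pfx : ∀ {n} → Omega n → ℕ → List (Fin n)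
pfx w zero = []
pfx w (suc k) = w 0 ∷ pfx (λ i → w (suc i)) k

InLω : ∀ {n} → (List (Fin n) → Set) → Omega n → Set
InLω L w = ∃ λ k → L (pfx w k)

SameLω : ∀ {n} → (List (Fin n) → Set) → (List (Fin n) → Set) → Set
SameLω L L' = ∀ w → (InLω L w → InLω L' w) × (InLω L' w → InLω L w)

_≃ωc_ : ∀ {n} → Mon n → Mon n → Set
m ≃ωc k = SameLω (La m) (La k) × SameLω (Lr m) (Lr k)

_≃ω_ : ∀ {n} → Mon n → Mon n → Set
_≃ω_ {n} m k = (σ : Subst n) → ClosedSubst σ → sub σ m ≃ωc sub σ k

data _⊢_≐_ {n : ℕ} (E : Mon n → Mon n → Set) : Mon n → Mon n → Set where
  d-ax    : ∀ {m k} → E m k → E ⊢ m ≐ k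
  d-refl  : ∀ {m} → E ⊢ m ≐ m
  d-sym   : ∀ {m k} → E ⊢ m ≐ k → E ⊢ k ≐ m
  d-trans : ∀ {m k l} → E ⊢ m ≐ k → E ⊢ k ≐ l → E ⊢ m ≐ l
  d-subst : ∀ {m k} (σ : Subst n) → E ⊢ m ≐ k → E ⊢ sub σ m ≐ sub σ k
  d-pre   : ∀ {m k} (a : Fin n) → E ⊢ m ≐ k → E ⊢ (a ∙ m) ≐ (a ∙ k)
  d-sum   : ∀ {m m' k k'} → E ⊢ m ≐ m' → E ⊢ k ≐ k' → E ⊢ (m ⊕ k) ≐ (m' ⊕ k')

Sum : ∀ {n} → List (Mon n) → Mon n
Sum [] = end
Sum (m ∷ []) = m
Sum (m ∷ k ∷ ms) = m ⊕ Sum (k ∷ ms)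

sumAct : ∀ {n} → Mon n → Mon n
sumAct {n} m = Sum (map (λ a → a ∙ m) (allFin n))

_∙∙_ : ∀ {n} → List (Fin n) → Mon n → Mon n
s ∙∙ m = foldr _∙_ m s

-- s^i (i ≥ 1 in uses below)
pow : ∀ {n} → List (Fin n) → ℕ → List (Fin n)
pow s zero = []
pow s (suc i) = s ++ pow s i

isPre : ∀ {n} → List (Fin n) → List (Fin n) → Bool
isPre [] _ = true
isPre (a ∷ s) [] = false
isPre (a ∷ s) (b ∷ t) = does (a ≟F b) ∧ isPre s t

wordsExact : ∀ n → ℕ → List (List (Fin n))
wordsExact n zero = [] ∷ []
wordsExact n (suc l) = concatMap (λ a → map (a ∷_) (wordsExact n l)) (allFin n)

wordsLe : ∀ n → ℕ → List (List (Fin n))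
wordsLe n l = concatMap (wordsExact n) (upTo (suc l))

barLe : ∀ {n} → List (Fin n) → Mon n → Mon n
barLe {n} s m =
  Sum (map (λ s' → s' ∙∙ m) (filterᵇ (λ s' → not (isPre s' s)) (wordsLe n (length s))))

bar : ∀ {n} → List (Fin n) → Mon n → Mon n
bar s m = barLe s m ⊕ (s ∙∙ sumAct m)

-- \overline{s}^{(k)}(m), defined for k ≥ 1; argument k = suc j
barK : ∀ {n} → List (Fin n) → ℕ → Mon n → Mon n
barK s zero m = bar s m
barK s (suc j) m =
  Sum (map (λ i → pow s i ∙∙ barLe s m) (filterᵇ (λ i → not (i Data.Nat.≡ᵇ 0)) (upTo (suc j))))
  ⊕ (pow s (suc j) ∙∙ bar s m)

x₀ y₀ z₀ : ∀ {n} → Mon n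
x₀ = var 0
y₀ = var 1
z₀ = var 2

-- The axiom system E'_{ω,f} = E_v ∪ {Y_ω, N_ω, O1} ∪ O
-- (O2 s j) is the equation (O2_{s,k}) with k = suc j
data E'ωf {n : ℕ} : Mon n → Mon n → Set where
  A1 : E'ωf (x₀ ⊕ y₀) (y₀ ⊕ x₀)
  A2 : E'ωf (x₀ ⊕ (y₀ ⊕ z₀)) ((x₀ ⊕ y₀) ⊕ z₀)
  A3 : E'ωf (x₀ ⊕ x₀) x₀
  A4 : E'ωf (x₀ ⊕ end) x₀
  Ea : (a : Fin n) → E'ωf (a ∙ end) end
  Ya : (a : Fin n) → E'ωf yes (yes ⊕ a ∙ yes)
  Na : (a : Fin n) → E'ωf no (no ⊕ a ∙ no)
  Da : (a : Fin n) → E'ωf (a ∙ (x₀ ⊕ y₀)) (a ∙ x₀ ⊕ a ∙ y₀)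
  Yω : E'ωf yes (sumAct yes)
  Nω : E'ωf no (sumAct no)
  O1 : E'ωf (yes ⊕ no) (yes ⊕ no ⊕ x₀)
  O2 : (s : List (Fin n)) (j : ℕ) →
       E'ωf (x₀ ⊕ (s ∙∙ x₀) ⊕ barK s j (yes ⊕ no)) (x₀ ⊕ barK s j (yes ⊕ no))

{-# OPTIONS --safe #-}

-- If every verdict that a closed instance σk reaches on an ω-word is also reached by σm,
-- then m = m + k is derivable; used in both directions this gives m = k.  As k is the sum
-- of its atoms p.l (l ∈ {yes, no, x}), it suffices to absorb each atom into m.
-- For an atom p.v with v conclusive, instantiate every variable by end and fix any w with
-- |w| = depth m: the ω-word p w a₀^ω is decided v by m through an atom q.v no longer than
-- p w, hence a prefix of it, so m absorbs (p w).v; Y_ω and N_ω fold these extensions back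
-- into p.v.
-- For an atom p.x that m lacks, instantiate x by w a₀^|p| b₀ . v instead: its single b₀
-- pins every occurrence of this word in p w a₀^|p| b₀ a₀^ω to offset |p|, so no variable of
-- m produces the verdict, m absorbs p.yes and p.no, and O1 turns p.(yes + no) into
-- p.(yes + no + x).

module Submission where

open import Defs
open import Data.Empty using (⊥; ⊥-elim)
open import Data.Fin using (Fin; zero; suc) renaming (_≟_ to _≟ᶠ_)
open import Data.List using (List; []; _∷_; _++_; [_]; _∷ʳ_; length; allFin)
open import Data.List.Properties using (++-assoc; ++-identityʳ; foldr-++; length-++-≤ʳ)
open import Data.List.Relation.Unary.All using (All; []; _∷_; universal)
open import Data.List.Relation.Unary.All.Properties using (map⁺)
open import Data.Nat using (ℕ; zero; suc; _≤_; _+_; _⊔_; z≤n; s≤s) renaming (_≟_ to _≟ℕ_)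
open import Data.Nat.Properties using (+-commutativeSemigroup; ≤-trans; m≤m⊔n; m≤n⊔m; suc-injective)
open import Algebra.Properties.CommutativeSemigroup +-commutativeSemigroup using (x∙yz≈z∙yx)
open import Data.Product using (∃-syntax; _×_; _,_; proj₁; proj₂; map₂; swap)
open import Data.Sum using (inj₁; inj₂; [_,_]′)
open import Data.Unit using (⊤; tt)
open import Function using (_∘_; const)
open import Relation.Binary.Bundles using (Setoid)
open import Relation.Binary.Construct.Closure.ReflexiveTransitive using (ε; _◅_)
open import Relation.Binary.PropositionalEquality using (_≡_; _≢_; refl; sym; cong; subst; module ≡-Reasoning)
open import Relation.Nullary using (¬_; Dec; map′; _×-dec_; _⊎-dec_)
  renaming (yes to dec-yes; no to dec-no)

module _ {n : ℕ} where

  private variable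
    a : Fin n
    m m′ m₀ k l v A B : Mon n
    p q r s t : List (Fin n)
    σ : Subst n
    W V : Omega n
    x : ℕ

  infix 4 _≈_ _⊒_

  _≈_ : Mon n → Mon n → Set
  A ≈ B = E'ωf ⊢ A ≐ B

  ≈-setoid : Setoid _ _
  ≈-setoid = record
    { Carrier = Mon n
    ; _≈_ = _≈_
    ; isEquivalence = record { refl = d-refl ; sym = d-sym ; trans = d-trans }
    }

  open import Relation.Binary.Reasoning.Setoid ≈-setoid

  -- Derived equations and the summand preorder

  ⟨_,_,_⟩ : Mon n → Mon n → Mon n → Subst n
  ⟨ A , B , C ⟩ 0 = A
  ⟨ A , B , C ⟩ 1 = B
  ⟨ A , B , C ⟩ _ = C

  ⊕-comm : ∀ A B → A ⊕ B ≈ B ⊕ A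
  ⊕-comm A B = d-subst ⟨ A , B , end ⟩ (d-ax A1)

  ⊕-assoc : ∀ A B C → A ⊕ (B ⊕ C) ≈ (A ⊕ B) ⊕ C
  ⊕-assoc A B C = d-subst ⟨ A , B , C ⟩ (d-ax A2)

  ⊕-idem : ∀ A → A ⊕ A ≈ A
  ⊕-idem A = d-subst ⟨ A , end , end ⟩ (d-ax A3)

  ⊕-identityʳ : ∀ A → A ⊕ end ≈ A
  ⊕-identityʳ A = d-subst ⟨ A , end , end ⟩ (d-ax A4)

  ∙-distrib-⊕ : ∀ a A B → a ∙ (A ⊕ B) ≈ a ∙ A ⊕ a ∙ B
  ∙-distrib-⊕ a A B = d-subst ⟨ A , B , end ⟩ (d-ax (Da a))

  ∙∙-cong : ∀ q → A ≈ B → q ∙∙ A ≈ q ∙∙ B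
  ∙∙-cong []      A≈B = A≈B
  ∙∙-cong (a ∷ q) A≈B = d-pre a (∙∙-cong q A≈B)

  ∙∙-distrib-⊕ : ∀ q A B → q ∙∙ (A ⊕ B) ≈ q ∙∙ A ⊕ q ∙∙ B
  ∙∙-distrib-⊕ []      A B = d-refl
  ∙∙-distrib-⊕ (a ∷ q) A B = d-trans (d-pre a (∙∙-distrib-⊕ q A B)) (∙-distrib-⊕ a _ _)

  ∙∙-end : ∀ q → q ∙∙ end ≈ end
  ∙∙-end []      = d-refl
  ∙∙-end (a ∷ q) = d-trans (d-pre a (∙∙-end q)) (d-ax (Ea a))

  ∙∙-++ : ∀ q r A → (q ++ r) ∙∙ A ≡ q ∙∙ (r ∙∙ A)
  ∙∙-++ q r A = foldr-++ (_∙_ {n}) A q r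

  ∷ʳ-∙∙ : ∀ q a A → (q ∷ʳ a) ∙∙ A ≡ q ∙∙ (a ∙ A)
  ∷ʳ-∙∙ q a A = ∙∙-++ q [ a ] A

  _⊒_ : Mon n → Mon n → Set
  m ⊒ A = m ≈ m ⊕ A

  ⊒-refl : m ⊒ m
  ⊒-refl {m} = d-sym (⊕-idem m)

  ⊒-trans : m ⊒ A → A ⊒ B → m ⊒ B
  ⊒-trans {m} {A} {B} m⊒A A⊒B = begin
    m            ≈⟨ m⊒A ⟩
    m ⊕ A        ≈⟨ d-sum d-refl A⊒B ⟩
    m ⊕ (A ⊕ B)  ≈⟨ ⊕-assoc m A B ⟩
    (m ⊕ A) ⊕ B  ≈⟨ d-sum m⊒A d-refl ⟨
    m ⊕ B        ∎

  ⊒-antisym : m ⊒ k → k ⊒ m → m ≈ k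
  ⊒-antisym {m} {k} m⊒k k⊒m = d-trans m⊒k (d-trans (⊕-comm m k) (d-sym k⊒m))

  ⊒-respʳ-≈ : A ≈ B → m ⊒ A → m ⊒ B
  ⊒-respʳ-≈ A≈B m⊒A = d-trans m⊒A (d-sum d-refl A≈B)

  ⊒-end : m ⊒ end
  ⊒-end {m} = d-sym (⊕-identityʳ m)

  ⊒-⊕ : m ⊒ A → m ⊒ B → m ⊒ A ⊕ B
  ⊒-⊕ {m} {A} {B} m⊒A m⊒B = begin
    m            ≈⟨ m⊒B ⟩
    m ⊕ B        ≈⟨ d-sum m⊒A d-refl ⟩
    (m ⊕ A) ⊕ B  ≈⟨ ⊕-assoc m A B ⟨
    m ⊕ (A ⊕ B)  ∎

  ⊕-⊒ˡ : m ⊕ k ⊒ m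
  ⊕-⊒ˡ {m} {k} = begin
    m ⊕ k        ≈⟨ d-sum (⊕-idem m) d-refl ⟨
    (m ⊕ m) ⊕ k  ≈⟨ ⊕-assoc m m k ⟨
    m ⊕ (m ⊕ k)  ≈⟨ d-sum d-refl (⊕-comm m k) ⟩
    m ⊕ (k ⊕ m)  ≈⟨ ⊕-assoc m k m ⟩
    (m ⊕ k) ⊕ m  ∎

  ⊕-⊒ʳ : m ⊕ k ⊒ k
  ⊕-⊒ʳ {m} {k} = begin
    m ⊕ k        ≈⟨ d-sum d-refl (⊕-idem k) ⟨
    m ⊕ (k ⊕ k)  ≈⟨ ⊕-assoc m k k ⟩
    (m ⊕ k) ⊕ k  ∎

  ⊒-∙ : A ⊒ B → a ∙ A ⊒ a ∙ B
  ⊒-∙ {a = a} A⊒B = d-trans (d-pre a A⊒B) (∙-distrib-⊕ a _ _)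

  ⊒-∙∙ : ∀ q → A ⊒ B → q ∙∙ A ⊒ q ∙∙ B
  ⊒-∙∙ []      A⊒B = A⊒B
  ⊒-∙∙ (a ∷ q) A⊒B = ⊒-∙ (⊒-∙∙ q A⊒B)

  ⊒-∙∙-Sum : ∀ {As} → All (λ A → m ⊒ q ∙∙ A) As → m ⊒ q ∙∙ Sum As
  ⊒-∙∙-Sum {q = q} []                 = ⊒-respʳ-≈ (d-sym (∙∙-end q)) ⊒-end
  ⊒-∙∙-Sum         (m⊒A ∷ [])         = m⊒A
  ⊒-∙∙-Sum {q = q} (m⊒A ∷ m⊒As@(_ ∷ _)) =
    ⊒-respʳ-≈ (d-sym (∙∙-distrib-⊕ q _ _)) (⊒-⊕ m⊒A (⊒-∙∙-Sum {q = q} m⊒As))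

  yes⊕no-⊒ : ∀ A → yes ⊕ no ⊒ A
  yes⊕no-⊒ A = d-subst ⟨ A , end , end ⟩ (d-ax O1)

  data Conclusive : Mon n → Set where
    is-yes : Conclusive yes
    is-no  : Conclusive no

  conclusive-sumAct : Conclusive v → v ≈ sumAct v
  conclusive-sumAct is-yes = d-ax Yω
  conclusive-sumAct is-no  = d-ax Nω

  conclusive-⊒-∙ : Conclusive v → ∀ a → v ⊒ a ∙ v
  conclusive-⊒-∙ is-yes a = d-ax (Ya a)
  conclusive-⊒-∙ is-no  a = d-ax (Na a)

  conclusive-⊒-∙∙ : Conclusive v → ∀ r → v ⊒ r ∙∙ v
  conclusive-⊒-∙∙ c []      = ⊒-refl
  conclusive-⊒-∙∙ c (a ∷ r) = ⊒-trans (conclusive-⊒-∙ c a) (⊒-∙ (conclusive-⊒-∙∙ c r))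

  ⊒-∙∙-extensions : Conclusive v → ∀ d p →
                    (∀ w → length w ≡ d → m ⊒ (p ++ w) ∙∙ v) → m ⊒ p ∙∙ v
  ⊒-∙∙-extensions {v} {m} c zero p h = subst (λ t → m ⊒ t ∙∙ v) (++-identityʳ p) (h [] refl)
  ⊒-∙∙-extensions {v} {m} c (suc d) p h =
    ⊒-respʳ-≈ (∙∙-cong p (d-sym (conclusive-sumAct c)))
      (⊒-∙∙-Sum {q = p} (map⁺ (universal ⊒-∙∙-∙ (allFin n))))
    where
    ⊒-∙∙-∙ : ∀ a → m ⊒ p ∙∙ (a ∙ v)
    ⊒-∙∙-∙ a = subst (m ⊒_) (∷ʳ-∙∙ p a v)
      (⊒-∙∙-extensions {v = v} {m = m} c d (p ∷ʳ a) λ w |w|≡d →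
        subst (λ t → m ⊒ t ∙∙ v) (sym (++-assoc p [ a ] w)) (h (a ∷ w) (cong suc |w|≡d)))

  -- Atoms

  data Leaf : Mon n → Set where
    leaf-verdict : Conclusive v → Leaf v
    leaf-var     : ∀ x → Leaf (var x)

  data Atom : Mon n → List (Fin n) → Mon n → Set where
    at-leaf : Leaf l → Atom l [] l
    at-⊕ˡ   : Atom m p l → Atom (m ⊕ k) p l
    at-⊕ʳ   : Atom k p l → Atom (m ⊕ k) p l
    at-∙    : Atom m p l → Atom (a ∙ m) (a ∷ p) l

  leaf : Atom m p l → Leaf l
  leaf (at-leaf lf) = lf
  leaf (at-⊕ˡ at)   = leaf at
  leaf (at-⊕ʳ at)   = leaf at
  leaf (at-∙ at)    = leaf at

  atom-⊒ : Atom m p l → m ⊒ p ∙∙ l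
  atom-⊒ (at-leaf _) = ⊒-refl
  atom-⊒ (at-⊕ˡ at)  = ⊒-trans ⊕-⊒ˡ (atom-⊒ at)
  atom-⊒ (at-⊕ʳ at)  = ⊒-trans ⊕-⊒ʳ (atom-⊒ at)
  atom-⊒ (at-∙ at)   = ⊒-∙ (atom-⊒ at)

  atom-⊒-extension : Conclusive v → Atom m q v → ∀ r → m ⊒ (q ++ r) ∙∙ v
  atom-⊒-extension {v} {m} {q} c at r =
    subst (m ⊒_) (sym (∙∙-++ q r v)) (⊒-trans (atom-⊒ at) (⊒-∙∙ q (conclusive-⊒-∙∙ c r)))

  atoms-⊒ : (∀ {p l} → Atom k p l → m ⊒ p ∙∙ l) → m ⊒ k
  atoms-⊒ {k} {m} = go [] k
    where
    go : ∀ q k → (∀ {p l} → Atom k p l → m ⊒ q ∙∙ (p ∙∙ l)) → m ⊒ q ∙∙ k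
    go q end     h = ⊒-respʳ-≈ (d-sym (∙∙-end q)) ⊒-end
    go q yes     h = h (at-leaf (leaf-verdict is-yes))
    go q no      h = h (at-leaf (leaf-verdict is-no))
    go q (var x) h = h (at-leaf (leaf-var x))
    go q (a ∙ k) h = subst (m ⊒_) (∷ʳ-∙∙ q a k) (go (q ∷ʳ a) k λ {p} {l} at →
      subst (m ⊒_) (sym (∷ʳ-∙∙ q a (p ∙∙ l))) (h (at-∙ at)))
    go q (k₁ ⊕ k₂) h = ⊒-respʳ-≈ (d-sym (∙∙-distrib-⊕ q k₁ k₂))
      (⊒-⊕ (go q k₁ (h ∘ at-⊕ˡ)) (go q k₂ (h ∘ at-⊕ʳ)))

  atom-var? : ∀ m p x → Dec (Atom m p (var x))
  atom-var? end       p       x = dec-no λ ()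
  atom-var? yes       p       x = dec-no λ ()
  atom-var? no        p       x = dec-no λ ()
  atom-var? (var y)   []      x =
    map′ (λ { refl → at-leaf (leaf-var y) }) (λ { (at-leaf _) → refl }) (y ≟ℕ x)
  atom-var? (var y)   (_ ∷ _) x = dec-no λ ()
  atom-var? (a ∙ m)   []      x = dec-no λ ()
  atom-var? (a ∙ m)   (b ∷ p) x =
    map′ (λ { (refl , at) → at-∙ at }) (λ { (at-∙ at) → refl , at }) ((a ≟ᶠ b) ×-dec atom-var? m p x)
  atom-var? (m ⊕ k)   p       x =
    map′ [ at-⊕ˡ , at-⊕ʳ ]′ (λ { (at-⊕ˡ at) → inj₁ at ; (at-⊕ʳ at) → inj₂ at })
      (atom-var? m p x ⊎-dec atom-var? k p x)

  depth : Mon n → ℕ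
  depth (a ∙ m) = suc (depth m)
  depth (m ⊕ k) = depth m ⊔ depth k
  depth _       = 0

  atom-length : Atom m p l → length p ≤ depth m
  atom-length (at-leaf _)          = z≤n
  atom-length (at-⊕ˡ {m} {k = k} at) = ≤-trans (atom-length at) (m≤m⊔n (depth m) (depth k))
  atom-length (at-⊕ʳ {k} {m = m} at) = ≤-trans (atom-length at) (m≤n⊔m (depth m) (depth k))
  atom-length (at-∙ at)            = s≤s (atom-length at)

  -- Traces reaching a verdict

  data Reaches : Mon n → List (Fin n) → Mon n → Set where
    reach-yes : Reaches yes s yes
    reach-no  : Reaches no s no
    reach-⊕ˡ  : Reaches m s v → Reaches (m ⊕ k) s v
    reach-⊕ʳ  : Reaches k s v → Reaches (m ⊕ k) s v
    reach-∙   : Reaches m s v → Reaches (a ∙ m) (a ∷ s) v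

  reaches-self : Conclusive v → Reaches v s v
  reaches-self is-yes = reach-yes
  reaches-self is-no  = reach-no

  reaches-sub-self : Conclusive v → Reaches (sub σ v) s v
  reaches-sub-self is-yes = reach-yes
  reaches-sub-self is-no  = reach-no

  reached-conclusive : Reaches m s v → Conclusive v
  reached-conclusive reach-yes    = is-yes
  reached-conclusive reach-no     = is-no
  reached-conclusive (reach-⊕ˡ r) = reached-conclusive r
  reached-conclusive (reach-⊕ʳ r) = reached-conclusive r
  reached-conclusive (reach-∙ r)  = reached-conclusive r

  conclusive⇒verdict : Conclusive v → IsVerdict v
  conclusive⇒verdict is-yes = v-yes
  conclusive⇒verdict is-no  = v-no

  τ-step-reaches : Step m τ m′ → Reaches m′ s v → Reaches m s v
  τ-step-reaches (s-sumL st) r = reach-⊕ˡ (τ-step-reaches st r)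
  τ-step-reaches (s-sumR st) r = reach-⊕ʳ (τ-step-reaches st r)
  τ-step-reaches (s-verd _)  r = r

  act-step-reaches : Step m (act a) m′ → Reaches m′ s v → Reaches m (a ∷ s) v
  act-step-reaches s-pre              r         = reach-∙ r
  act-step-reaches (s-sumL st)        r         = reach-⊕ˡ (act-step-reaches st r)
  act-step-reaches (s-sumR st)        r         = reach-⊕ʳ (act-step-reaches st r)
  act-step-reaches (s-verd v-yes)     reach-yes = reach-yes
  act-step-reaches (s-verd v-no)      reach-no  = reach-no

  τ*-reaches : TauStar m m′ → Reaches m′ s v → Reaches m s v
  τ*-reaches ε           r = r
  τ*-reaches (st ◅ sts)  r = τ-step-reaches st (τ*-reaches sts r)

  weak1-reaches : Weak1 a m m′ → Reaches m′ s v → Reaches m (a ∷ s) v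
  weak1-reaches (_ , _ , sts , st , sts′) r = τ*-reaches sts (act-step-reaches st (τ*-reaches sts′ r))

  weak⇒reaches : Conclusive v → Weak s m v → Reaches m s v
  weak⇒reaches {v} {s} c = go s
    where
    go : ∀ {m} s → Weak s m v → Reaches m s v
    go []          sts            = τ*-reaches sts (reaches-self c)
    go (a ∷ [])    w              = weak1-reaches w (reaches-self c)
    go (a ∷ b ∷ s) (_ , w , ws)   = weak1-reaches w (go (b ∷ s) ws)

  verdict-weak : IsVerdict v → ∀ s → Weak s v v
  verdict-weak iv []          = ε
  verdict-weak iv (a ∷ [])    = _ , _ , ε , s-verd iv , ε
  verdict-weak iv (a ∷ b ∷ s) = _ , (_ , _ , ε , s-verd iv , ε) , verdict-weak iv (b ∷ s)

  weak1-lift : (∀ {α m′} → Step m α m′ → Step m₀ α m′) → Weak1 a m m′ → Weak1 a m₀ m′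
  weak1-lift f (_ , _ , ε ,         st , sts′) = _ , _ , ε , f st , sts′
  weak1-lift f (_ , _ , st′ ◅ sts , st , sts′) = _ , _ , f st′ ◅ sts , st , sts′

  weak-lift : (∀ {α m′} → Step m α m′ → Step m₀ α m′) → IsVerdict v → ∀ s → Weak s m v → Weak s m₀ v
  weak-lift f iv []          ε              = f (s-verd iv) ◅ ε
  weak-lift f iv []          (st ◅ sts)     = f st ◅ sts
  weak-lift f iv (a ∷ [])    w              = weak1-lift f w
  weak-lift f iv (a ∷ b ∷ s) (m₁ , w₁ , ws) = m₁ , weak1-lift f w₁ , ws

  reaches⇒weak : Reaches m s v → Weak s m v
  reaches⇒weak (reach-yes {s}) = verdict-weak v-yes s
  reaches⇒weak (reach-no {s})  = verdict-weak v-no s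
  reaches⇒weak (reach-⊕ˡ {m = m} {s = s} r) =
    weak-lift {m = m} s-sumL (conclusive⇒verdict (reached-conclusive r)) s (reaches⇒weak r)
  reaches⇒weak (reach-⊕ʳ {k = k} {s = s} r) =
    weak-lift {m = k} s-sumR (conclusive⇒verdict (reached-conclusive r)) s (reaches⇒weak r)
  reaches⇒weak (reach-∙ {s = []} r)    = _ , _ , ε , s-pre , reaches⇒weak r
  reaches⇒weak (reach-∙ {s = _ ∷ _} r) = _ , (_ , _ , ε , s-pre , ε) , reaches⇒weak r

  atom-reaches : Atom k p l → Reaches (sub σ l) s v → Reaches (sub σ k) (p ++ s) v
  atom-reaches (at-leaf _) r = r
  atom-reaches (at-⊕ˡ at)  r = reach-⊕ˡ (atom-reaches at r)
  atom-reaches (at-⊕ʳ at)  r = reach-⊕ʳ (atom-reaches at r)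
  atom-reaches (at-∙ at)   r = reach-∙ (atom-reaches at r)

  reaches-sub : ∀ m → Reaches (sub σ m) s v →
                ∃[ q ] ∃[ l ] ∃[ s′ ] Atom m q l × s ≡ q ++ s′ × Reaches (sub σ l) s′ v
  reaches-sub yes     r = [] , yes , _ , at-leaf (leaf-verdict is-yes) , refl , r
  reaches-sub no      r = [] , no , _ , at-leaf (leaf-verdict is-no) , refl , r
  reaches-sub (var x) r = [] , var x , _ , at-leaf (leaf-var x) , refl , r
  reaches-sub (a ∙ m) (reach-∙ r) with reaches-sub m r
  ... | q , l , s′ , at , refl , r′ = a ∷ q , l , s′ , at-∙ at , refl , r′
  reaches-sub (m ⊕ k) (reach-⊕ˡ r) with reaches-sub m r
  ... | q , l , s′ , at , eq , r′ = q , l , s′ , at-⊕ˡ at , eq , r′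
  reaches-sub (m ⊕ k) (reach-⊕ʳ r) with reaches-sub k r
  ... | q , l , s′ , at , eq , r′ = q , l , s′ , at-⊕ʳ at , eq , r′

  ∙∙-reaches : Conclusive v → ∀ u → Reaches (u ∙∙ v) u v
  ∙∙-reaches c []      = reaches-self c
  ∙∙-reaches c (a ∷ u) = reach-∙ (∙∙-reaches c u)

  ∙∙-reaches⁻ : ∀ u → Reaches (u ∙∙ A) s v → ∃[ s′ ] s ≡ u ++ s′
  ∙∙-reaches⁻ []      r           = _ , refl
  ∙∙-reaches⁻ (a ∷ u) (reach-∙ r) = map₂ (cong (a ∷_)) (∙∙-reaches⁻ u r)

  ∙∙-closed : ∀ u → Closed A → Closed (u ∙∙ A)
  ∙∙-closed []      c = c
  ∙∙-closed (a ∷ u) c = c-pre (∙∙-closed u c)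

  conclusive-closed : Conclusive v → Closed v
  conclusive-closed is-yes = c-yes
  conclusive-closed is-no  = c-no

  _↦_ : ℕ → Mon n → Subst n
  (x ↦ A) y with x ≟ℕ y
  ... | dec-yes _ = A
  ... | dec-no _  = end

  ↦-closed : Closed A → ClosedSubst (x ↦ A)
  ↦-closed {x = x} c y with x ≟ℕ y
  ... | dec-yes _ = c
  ... | dec-no _  = c-end

  ↦-self : Reaches A s v → Reaches ((x ↦ A) x) s v
  ↦-self {x = x} r with x ≟ℕ x
  ... | dec-yes _   = r
  ... | dec-no x≢x  = ⊥-elim (x≢x refl)

  ↦-reaches : ∀ x y → Reaches ((x ↦ A) y) s v → x ≡ y × Reaches A s v
  ↦-reaches x y r with x ≟ℕ y
  ↦-reaches x y r  | dec-yes x≡y = x≡y , r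
  ↦-reaches x y () | dec-no _

  -- Finite prefixes of ω-words

  _++ω_ : List (Fin n) → Omega n → Omega n
  ([]      ++ω V) i       = V i
  ((c ∷ t) ++ω V) zero    = c
  ((c ∷ t) ++ω V) (suc i) = (t ++ω V) i

  infixr 5 _++ω_
  infix 4 _≼_

  _≼_ : List (Fin n) → Omega n → Set
  []      ≼ W = ⊤
  (c ∷ t) ≼ W = c ≡ W 0 × t ≼ (W ∘ suc)

  pfx-≼ : ∀ W j → pfx W j ≼ W
  pfx-≼ W zero    = tt
  pfx-≼ W (suc j) = refl , pfx-≼ (W ∘ suc) j

  ≼⇒pfx : ∀ t → t ≼ W → pfx W (length t) ≡ t
  ≼⇒pfx []      _          = refl
  ≼⇒pfx (c ∷ t) (refl , h) = cong (_ ∷_) (≼⇒pfx t h)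

  ≼-reaches : t ≼ W → Reaches m t v → InLω (λ s → Reaches m s v) W
  ≼-reaches {t} {m = m} {v = v} t≼W r = length t , subst (λ s → Reaches m s v) (sym (≼⇒pfx t t≼W)) r

  ≼-++⁻ˡ : ∀ q → (q ++ r) ≼ W → q ≼ W
  ≼-++⁻ˡ []      _       = tt
  ≼-++⁻ˡ (c ∷ q) (e , h) = e , ≼-++⁻ˡ q h

  ≼-++⁻ʳ : ∀ q → (q ++ r) ≼ W → r ≼ (W ∘ (length q +_))
  ≼-++⁻ʳ []      h       = h
  ≼-++⁻ʳ (c ∷ q) (_ , h) = ≼-++⁻ʳ q h

  ++ω-≼ : ∀ t → t ≼ (t ++ω V)
  ++ω-≼ []      = tt
  ++ω-≼ (c ∷ t) = refl , ++ω-≼ t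

  ≼-++ω : ∀ t → r ≼ V → (t ++ r) ≼ (t ++ω V)
  ≼-++ω []      h = h
  ≼-++ω (c ∷ t) h = refl , ≼-++ω t h

  ++ω-index : ∀ t i → (t ++ω V) (length t + i) ≡ V i
  ++ω-index []      i = refl
  ++ω-index (c ∷ t) i = ++ω-index t i

  ≼-prefix : q ≼ W → t ≼ W → length q ≤ length t → ∃[ r ] t ≡ q ++ r
  ≼-prefix {[]}    {t = t}     _          _          _         = t , refl
  ≼-prefix {c ∷ q} {t = d ∷ t} (refl , h) (refl , h′) (s≤s q≤t) =
    map₂ (cong (c ∷_)) (≼-prefix h h′ q≤t)

  ≼-unique : q ≼ W → t ≼ W → length q ≡ length t → q ≡ t
  ≼-unique {[]}    {t = []}    _          _          _   = refl
  ≼-unique {c ∷ q} {t = d ∷ t} (refl , h) (refl , h′) |q|≡|t| =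
    cong (c ∷_) (≼-unique h h′ (suc-injective |q|≡|t|))

  NoVarReach : Subst n → Mon n → Omega n → Mon n → Set
  NoVarReach σ m W v = ∀ {q y s} → Atom m q (var y) → Reaches (σ y) s v → (q ++ s) ≼ W → ⊥

  -- An atom of m that decides W has length at most depth m, so it is a prefix of p w.
  ⊒-from-ω-word : ∀ p w → length w ≡ depth m → (p ++ w) ≼ W →
                  InLω (λ s → Reaches (sub σ m) s v) W → NoVarReach σ m W v → m ⊒ (p ++ w) ∙∙ v
  ⊒-from-ω-word {m} {W} {σ} {v} p w |w|≡ pw≼W (j , r) no-var with reaches-sub m r
  ... | q , l , s , at , eq , r′ = by-leaf (leaf at) at r′
    where
    qs≼W : (q ++ s) ≼ W
    qs≼W = subst (_≼ W) eq (pfx-≼ W j)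
    found : Conclusive v → Atom m q v → m ⊒ (p ++ w) ∙∙ v
    found c at′ with ≼-prefix (≼-++⁻ˡ q qs≼W) pw≼W
                       (≤-trans (atom-length at′) (subst (_≤ length (p ++ w)) |w|≡ (length-++-≤ʳ w {p})))
    ... | r , pw≡qr = subst (λ t → m ⊒ t ∙∙ v) (sym pw≡qr) (atom-⊒-extension c at′ r)
    by-leaf : ∀ {l} → Leaf l → Atom m q l → Reaches (sub σ l) s v → m ⊒ (p ++ w) ∙∙ v
    by-leaf (leaf-verdict is-yes) at′ reach-yes = found is-yes at′
    by-leaf (leaf-verdict is-no)  at′ reach-no  = found is-no at′
    by-leaf (leaf-var y)          at′ r″        = ⊥-elim (no-var at′ r″ qs≼W)

  _⊑_ : Mon n → Mon n → Set
  k ⊑ m = ∀ {v} σ → ClosedSubst σ → ∀ W →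
          InLω (λ s → Reaches (sub σ k) s v) W → InLω (λ s → Reaches (sub σ m) s v) W

  ≃ω⇒⊑ : ∀ (m k : Mon n) → m ≃ω k → k ⊑ m
  ≃ω⇒⊑ m k m≃k σ σ-closed W (j , r) with reached-conclusive r
  ... | is-yes = map₂ (weak⇒reaches is-yes) (proj₂ (proj₁ (m≃k σ σ-closed) W) (j , reaches⇒weak r))
  ... | is-no  = map₂ (weak⇒reaches is-no)  (proj₂ (proj₂ (m≃k σ σ-closed) W) (j , reaches⇒weak r))

  ≃ω-sym : ∀ (m k : Mon n) → m ≃ω k → k ≃ω m
  ≃ω-sym m k m≃k σ σ-closed with m≃k σ σ-closed
  ... | same-accept , same-reject = (λ W → swap (same-accept W)) , (λ W → swap (same-reject W))

module Complete {n : ℕ} (a₀ b₀ : Fin n) (a₀≢b₀ : a₀ ≢ b₀) where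

  private variable
    m k l v : Mon n
    p : List (Fin n)
    x : ℕ

  ⊒-verdict-atom : k ⊑ m → Conclusive v → Atom k p v → m ⊒ p ∙∙ v
  ⊒-verdict-atom {k} {m} {v} {p} k⊑m c at = ⊒-∙∙-extensions c (depth m) p ⊒-extension
    where
    ⊒-extension : ∀ w → length w ≡ depth m → m ⊒ (p ++ w) ∙∙ v
    ⊒-extension w |w|≡ =
      ⊒-from-ω-word p w |w|≡ pw≼W
        (k⊑m (const end) (const c-end) W (≼-reaches pw≼W (atom-reaches at (reaches-sub-self c))))
        λ _ ()
      where
      W : Omega n
      W = p ++ω w ++ω const a₀
      pw≼W : (p ++ w) ≼ W
      pw≼W = ≼-++ω p (++ω-≼ w)

  marker : ℕ → List (Fin n)
  marker zero    = [ b₀ ]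
  marker (suc L) = a₀ ∷ marker L

  beacon : ℕ → Omega n
  beacon L = marker L ++ω const a₀

  marker-≼ : ∀ L {V} → marker L ≼ V → V L ≡ b₀
  marker-≼ zero    (b₀≡ , _) = sym b₀≡
  marker-≼ (suc L) (_ , h)   = marker-≼ L h

  beacon-unique : ∀ L i → beacon L i ≡ b₀ → i ≡ L
  beacon-unique zero    zero    _     = refl
  beacon-unique zero    (suc i) a₀≡b₀ = ⊥-elim (a₀≢b₀ a₀≡b₀)
  beacon-unique (suc L) zero    a₀≡b₀ = ⊥-elim (a₀≢b₀ a₀≡b₀)
  beacon-unique (suc L) (suc i) eq    = cong suc (beacon-unique L i eq)

  -- Beyond the prefix p w, the word p w beacon(|p|) has its only b₀ at offset |p| + |w| + |p|.
  marked-offset : ∀ p w q {s} →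
                  (q ++ (w ++ marker (length p)) ++ s) ≼ (p ++ω w ++ω beacon (length p)) → q ≡ p
  marked-offset p w q h = ≼-unique (≼-++⁻ˡ q h) (++ω-≼ p) (beacon-unique L (length q) beacon-at)
    where
    open ≡-Reasoning
    L : ℕ
    L = length p
    W : Omega n
    W = p ++ω w ++ω beacon L
    marker≼ : marker L ≼ (λ i → W (length q + (length w + i)))
    marker≼ = ≼-++⁻ʳ w (≼-++⁻ˡ (w ++ marker L) (≼-++⁻ʳ q h))
    beacon-at : beacon L (length q) ≡ b₀
    beacon-at = begin
      beacon L (length q)                     ≡⟨ ++ω-index w (length q) ⟨
      (w ++ω beacon L) (length w + length q)  ≡⟨ ++ω-index p _ ⟨
      W (L + (length w + length q))           ≡⟨ cong W (x∙yz≈z∙yx L (length w) (length q)) ⟩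
      W (length q + (length w + L))           ≡⟨ marker-≼ L marker≼ ⟩
      b₀                                      ∎

  ¬atom-var⇒⊒-verdict : k ⊑ m → Atom k p (var x) → ¬ Atom m p (var x) → Conclusive v → m ⊒ p ∙∙ v
  ¬atom-var⇒⊒-verdict {k} {m} {p} {x} {v} k⊑m at ¬at c = ⊒-∙∙-extensions c (depth m) p ⊒-extension
    where
    ⊒-extension : ∀ w → length w ≡ depth m → m ⊒ (p ++ w) ∙∙ v
    ⊒-extension w |w|≡ =
      ⊒-from-ω-word p w |w|≡ (≼-++ω p (++ω-≼ w))
        (k⊑m σ (↦-closed (∙∙-closed u (conclusive-closed c))) W
          (≼-reaches (≼-++ω p (≼-++ω w (++ω-≼ (marker L)))) (atom-reaches at (↦-self (∙∙-reaches c u)))))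
        no-var
      where
      L : ℕ
      L = length p
      u : List (Fin n)
      u = w ++ marker L
      σ : Subst n
      σ = x ↦ (u ∙∙ v)
      W : Omega n
      W = p ++ω w ++ω beacon L
      no-var : NoVarReach σ m W v
      no-var {y = y} at′ r qs≼W with ↦-reaches x y r
      ... | refl , r′ with ∙∙-reaches⁻ u r′
      ... | _ , refl = ¬at (subst (λ q → Atom m q (var x)) (marked-offset p w _ qs≼W) at′)

  ⊒-var-atom : k ⊑ m → Atom k p (var x) → m ⊒ p ∙∙ var x
  ⊒-var-atom {k} {m} {p} {x} k⊑m at with atom-var? m p x
  ... | dec-yes at′ = atom-⊒ at′
  ... | dec-no ¬at  = ⊒-trans
    (⊒-respʳ-≈ (d-sym (∙∙-distrib-⊕ p yes no))
      (⊒-⊕ (¬atom-var⇒⊒-verdict k⊑m at ¬at is-yes) (¬atom-var⇒⊒-verdict k⊑m at ¬at is-no)))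
    (⊒-∙∙ p (yes⊕no-⊒ (var x)))

  ⊑⇒⊒ : k ⊑ m → m ⊒ k
  ⊑⇒⊒ {k} {m} k⊑m = atoms-⊒ ⊒-atom
    where
    ⊒-atom : Atom k p l → m ⊒ p ∙∙ l
    ⊒-atom at with leaf at
    ... | leaf-verdict c = ⊒-verdict-atom k⊑m c at
    ... | leaf-var _     = ⊒-var-atom k⊑m at

theorem8 : (n : ℕ) → 2 ≤ n → (m k : Mon n) → m ≃ω k → E'ωf ⊢ m ≐ k
theorem8 _ (s≤s (s≤s _)) m k m≃k =
  ⊒-antisym (⊑⇒⊒ (≃ω⇒⊑ m k m≃k)) (⊑⇒⊒ (≃ω⇒⊑ k m (≃ω-sym m k m≃k)))
  where open Complete zero (suc zero) (λ ())
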